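{- If $f\colon S\to S'$ is an $FT$-coalgebra morphism from $c\colon S\to FTS$ to $c'\colon S'\to FTS'$ (i.e. $c'\circ f=FTf\circ c$), then $\Phi^n_c(\bot_S)=\Phi^n_{c'}(\bot_{S'})\circ f$ for every $n\in\mathbb{N}$. Consequently, if $f$ is moreover a morphism of $I$-pointed coalgebras from $(i,c)$ to $(i',c')$ (i.e. additionally $f\circ i=i'$ for $i\colon I\to S$, $i'\colon I\to S'$), then $\bigvee_{n\in\mathbb{N}}\Phi^n_c(\bot_S)\circ i=\bigvee_{n\in\mathbb{N}}\Phi^n_{c'}(\bot_{S'})\circ i'$.
   Context: $\mathcal{C}$ is a category, $F$ an endofunctor and $T$ a monad on $\mathcal{C}$. $\Omega$ is an ordered object: for every object $X$, the hom-set $\mathcal{C}(X,\Omega)$ is a complete lattice, and every precomposition map $\mathcal{C}(Y,\Omega)\to\mathcal{C}(X,\Omega)$, $g\mapsto g\circ h$, preserves arbitrary joins; $\bot_X$ denotes the bottom of $\mathcal{C}(X,\Omega)$. $\tau\colon FT\Omega\to\Omega$ is a monotone algebra, i.e. $g\mapsto\tau\circ FTg$, $\mathcal{C}(X,\Omega)\to\mathcal{C}(FTX,\Omega)$, is monotone for every $X$. For an $FT$-coalgebra $c\colon S\to FTS$, $\Phi_c\colon\mathcal{C}(S,\Omega)\to\mathcal{C}(S,\Omega)$ is $\Phi_c(g):=\tau\circ FTg\circ c$. -}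

module Defs where

open import Level using (Level; suc; _⊔_; 0ℓ)
open import Data.Nat using (ℕ; zero) renaming (suc to 1+)
open import Data.Empty using (⊥)
open import Relation.Binary.PropositionalEquality using (_≡_)

record Category (o : Level) : Set (suc o) where
  infixr 9 _∘_
  field
    Obj  : Set o
    Hom  : Obj → Obj → Set
    id   : ∀ {A} → Hom A A
    _∘_  : ∀ {A B C} → Hom B C → Hom A B → Hom A C
    identityˡ : ∀ {A B} {f : Hom A B} → id ∘ f ≡ f
    identityʳ : ∀ {A B} {f : Hom A B} → f ∘ id ≡ f
    assoc : ∀ {A B C D} {f : Hom A B} {g : Hom B C} {h : Hom C D} →
            (h ∘ g) ∘ f ≡ h ∘ (g ∘ f)

record Endofunctor {o : Level} (C : Category o) : Set o where
  open Category C
  field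
    F₀ : Obj → Obj
    F₁ : ∀ {A B} → Hom A B → Hom (F₀ A) (F₀ B)
    F-id : ∀ {A} → F₁ (id {A}) ≡ id
    F-∘  : ∀ {A B C} {f : Hom A B} {g : Hom B C} → F₁ (g ∘ f) ≡ F₁ g ∘ F₁ f

record Monad {o : Level} (C : Category o) : Set o where
  open Category C
  field
    functor : Endofunctor C
  open Endofunctor functor renaming (F₀ to T₀; F₁ to T₁) public
  field
    η : ∀ X → Hom X (T₀ X)
    μ : ∀ X → Hom (T₀ (T₀ X)) (T₀ X)
    η-natural : ∀ {X Y} (f : Hom X Y) → η Y ∘ f ≡ T₁ f ∘ η X
    μ-natural : ∀ {X Y} (f : Hom X Y) → μ Y ∘ T₁ (T₁ f) ≡ T₁ f ∘ μ X
    unitˡ : ∀ {X} → μ X ∘ η (T₀ X) ≡ id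
    unitʳ : ∀ {X} → μ X ∘ T₁ (η X) ≡ id
    mult-assoc : ∀ {X} → μ X ∘ T₁ (μ X) ≡ μ X ∘ μ (T₀ X)

record OrderedObject {o : Level} (C : Category o) : Set (suc 0ℓ ⊔ o) where
  open Category C
  field
    Ω   : Obj
    _≤_ : ∀ {X} → Hom X Ω → Hom X Ω → Set
    ≤-refl    : ∀ {X} {g : Hom X Ω} → g ≤ g
    ≤-trans   : ∀ {X} {g h k : Hom X Ω} → g ≤ h → h ≤ k → g ≤ k
    ≤-antisym : ∀ {X} {g h : Hom X Ω} → g ≤ h → h ≤ g → g ≡ h
    ⋁ : ∀ {X} {I : Set} → (I → Hom X Ω) → Hom X Ω
    ⋁-upper : ∀ {X} {I : Set} (g : I → Hom X Ω) (i : I) → g i ≤ ⋁ g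
    ⋁-least : ∀ {X} {I : Set} (g : I → Hom X Ω) (h : Hom X Ω) →
              (∀ i → g i ≤ h) → ⋁ g ≤ h
    ⋁-precomp : ∀ {X Y} {I : Set} (g : I → Hom Y Ω) (h : Hom X Y) →
                ⋁ g ∘ h ≡ ⋁ (λ i → g i ∘ h)

  ⊥Ω : ∀ X → Hom X Ω
  ⊥Ω X = ⋁ {X} {⊥} (λ ())

iter : ∀ {a} {A : Set a} → ℕ → (A → A) → A → A
iter zero    φ x = x
iter (1+ n)  φ x = φ (iter n φ x)

module _ {o : Level} {C : Category o} (F : Endofunctor C) (T : Monad C) where
  open Category C
  open Endofunctor F
  open Monad T using (T₀; T₁)

  FT₀ : Obj → Obj
  FT₀ X = F₀ (T₀ X)

  FT₁ : ∀ {X Y} → Hom X Y → Hom (FT₀ X) (FT₀ Y)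
  FT₁ f = F₁ (T₁ f)

  module _ (O : OrderedObject C) where
    open OrderedObject O

    MonotoneAlgebra : Hom (FT₀ Ω) Ω → Set o
    MonotoneAlgebra τ = ∀ {X} {g h : Hom X Ω} →
                        g ≤ h → (τ ∘ FT₁ g) ≤ (τ ∘ FT₁ h)

    Φ : (τ : Hom (FT₀ Ω) Ω) → ∀ {S} → Hom S (FT₀ S) → Hom S Ω → Hom S Ω
    Φ τ c g = τ ∘ FT₁ g ∘ c

{-# OPTIONS --safe #-}
module Submission where

-- Precomposition with a coalgebra morphism f intertwines Φ_c' and Φ_c, and sends ⊥ to ⊥;
-- so it maps the Kleene chain of c' onto that of c, and since it preserves joins,
-- the pointed statement follows from f ∘ i = i'.

open import Defs
open import Data.Nat using (ℕ; zero; suc)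
open import Data.Product using (_×_; _,_)
open import Relation.Binary.PropositionalEquality
  using (_≡_; refl; sym; trans; cong; subst; module ≡-Reasoning)

iter-commute : ∀ {a b} {A : Set a} {B : Set b} {φ : A → A} {ψ : B → B} (k : B → A) →
               (∀ y → φ (k y) ≡ k (ψ y)) → ∀ n y → iter n φ (k y) ≡ k (iter n ψ y)
iter-commute             k φk≡kψ zero    y = refl
iter-commute {φ = φ} {ψ} k φk≡kψ (suc n) y =
  trans (cong φ (iter-commute k φk≡kψ n y)) (φk≡kψ (iter n ψ y))

module OrderedObjectProperties {o} {C : Category o} (O : OrderedObject C) where
  open Category C
  open OrderedObject O

  ⋁-cong : ∀ {X} {I : Set} {g h : I → Hom X Ω} → (∀ i → g i ≡ h i) → ⋁ g ≡ ⋁ h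
  ⋁-cong {g = g} {h} g≡h = ≤-antisym
    (⋁-least g (⋁ h) (λ i → subst (_≤ ⋁ h) (sym (g≡h i)) (⋁-upper h i)))
    (⋁-least h (⋁ g) (λ i → subst (_≤ ⋁ g) (g≡h i) (⋁-upper g i)))

  ⊥Ω-precomp : ∀ {X Y} (h : Hom X Y) → ⊥Ω Y ∘ h ≡ ⊥Ω X
  ⊥Ω-precomp h = trans (⋁-precomp _ h) (⋁-cong (λ ()))

module _ {o} {C : Category o} (F : Endofunctor C) (T : Monad C) where
  open Category C

  FT₁-∘ : ∀ {X Y Z} (g : Hom Y Z) (h : Hom X Y) → FT₁ F T (g ∘ h) ≡ FT₁ F T g ∘ FT₁ F T h
  FT₁-∘ g h = trans (cong F₁ T-∘) F-∘
    where
    open Endofunctor F using (F₁; F-∘)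
    open Monad T renaming (F-∘ to T-∘)

  IsCoalgebraHom : ∀ {S S'} → Hom S (FT₀ F T S) → Hom S' (FT₀ F T S') → Hom S S' → Set
  IsCoalgebraHom c c' f = c' ∘ f ≡ FT₁ F T f ∘ c

  module _ (O : OrderedObject C) (τ : Hom (FT₀ F T (OrderedObject.Ω O)) (OrderedObject.Ω O))
           {S S'} {c : Hom S (FT₀ F T S)} {c' : Hom S' (FT₀ F T S')} {f : Hom S S'}
           (hom : IsCoalgebraHom c c' f) where
    open OrderedObject O
    open OrderedObjectProperties O

    Φ-precomp : ∀ h → Φ F T O τ c (h ∘ f) ≡ Φ F T O τ c' h ∘ f
    Φ-precomp h = begin
      τ ∘ FT₁ F T (h ∘ f) ∘ c          ≡⟨ cong (λ k → τ ∘ k ∘ c) (FT₁-∘ h f) ⟩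
      τ ∘ (FT₁ F T h ∘ FT₁ F T f) ∘ c  ≡⟨ cong (τ ∘_) assoc ⟩
      τ ∘ FT₁ F T h ∘ FT₁ F T f ∘ c    ≡⟨ cong (λ k → τ ∘ FT₁ F T h ∘ k) (sym hom) ⟩
      τ ∘ FT₁ F T h ∘ c' ∘ f           ≡⟨ cong (τ ∘_) (sym assoc) ⟩
      τ ∘ (FT₁ F T h ∘ c') ∘ f         ≡⟨ sym assoc ⟩
      (τ ∘ FT₁ F T h ∘ c') ∘ f         ∎
      where open ≡-Reasoning

    iter-Φ-⊥Ω-precomp : ∀ n → iter n (Φ F T O τ c) (⊥Ω S) ≡ iter n (Φ F T O τ c') (⊥Ω S') ∘ f
    iter-Φ-⊥Ω-precomp n = begin
      iter n (Φ F T O τ c) (⊥Ω S)            ≡⟨ cong (iter n _) (sym (⊥Ω-precomp f)) ⟩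
      iter n (Φ F T O τ c) (⊥Ω S' ∘ f)       ≡⟨ iter-commute (_∘ f) Φ-precomp n (⊥Ω S') ⟩
      iter n (Φ F T O τ c') (⊥Ω S') ∘ f      ∎
      where open ≡-Reasoning

    ⋁-iter-Φ-⊥Ω-precomp : ⋁ (λ n → iter n (Φ F T O τ c) (⊥Ω S))
                        ≡ ⋁ (λ n → iter n (Φ F T O τ c') (⊥Ω S')) ∘ f
    ⋁-iter-Φ-⊥Ω-precomp =
      trans (⋁-cong iter-Φ-⊥Ω-precomp) (sym (⋁-precomp _ f))

    ⋁-iter-Φ-⊥Ω-pointed : ∀ {I} (i : Hom I S) (i' : Hom I S') → f ∘ i ≡ i' →
                          ⋁ (λ n → iter n (Φ F T O τ c) (⊥Ω S)) ∘ i
                          ≡ ⋁ (λ n → iter n (Φ F T O τ c') (⊥Ω S')) ∘ i'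
    ⋁-iter-Φ-⊥Ω-pointed i i' fi≡i' = begin
      ⋁ (λ n → iter n (Φ F T O τ c) (⊥Ω S)) ∘ i          ≡⟨ cong (_∘ i) ⋁-iter-Φ-⊥Ω-precomp ⟩
      (⋁ (λ n → iter n (Φ F T O τ c') (⊥Ω S')) ∘ f) ∘ i  ≡⟨ assoc ⟩
      ⋁ (λ n → iter n (Φ F T O τ c') (⊥Ω S')) ∘ f ∘ i    ≡⟨ cong (_ ∘_) fi≡i' ⟩
      ⋁ (λ n → iter n (Φ F T O τ c') (⊥Ω S')) ∘ i'       ∎
      where open ≡-Reasoning

open Category using (Obj; Hom; _∘_)
open OrderedObject using (⋁; ⊥Ω)

proposition5p5 : ∀ {o} (C : Category o) (F : Endofunctor C) (T : Monad C)
    (Ω : OrderedObject C)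
    (τ : Hom C (FT₀ F T (OrderedObject.Ω Ω)) (OrderedObject.Ω Ω)) →
    MonotoneAlgebra F T Ω τ →
    {S S' : Obj C} (c : Hom C S (FT₀ F T S)) (c' : Hom C S' (FT₀ F T S'))
    (f : Hom C S S') → _∘_ C c' f ≡ _∘_ C (FT₁ F T f) c →
    ((n : ℕ) → iter n (Φ F T Ω τ c) (⊥Ω Ω S)
                 ≡ _∘_ C (iter n (Φ F T Ω τ c') (⊥Ω Ω S')) f)
    × ({I : Obj C} (i : Hom C I S) (i' : Hom C I S') → _∘_ C f i ≡ i' →
       _∘_ C (⋁ Ω (λ (n : ℕ) → iter n (Φ F T Ω τ c) (⊥Ω Ω S))) i
         ≡ _∘_ C (⋁ Ω (λ (n : ℕ) → iter n (Φ F T Ω τ c') (⊥Ω Ω S'))) i')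
proposition5p5 C F T Ω τ _ c c' f hom =
  iter-Φ-⊥Ω-precomp F T Ω τ hom , ⋁-iter-Φ-⊥Ω-pointed F T Ω τ hom
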